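{- Let $1\le m\le n$ and $p:=n-m$. For all $S,T\in\binom{[n+m]}{n}$, $$\langle g_S,v_T\rangle=\begin{cases}1 & \text{if } S=T,\\ (-1)^{d_1+\cdots+d_p+\binom{p+1}{2}+1} & \text{if } S\cap T=\{d_1,\dots,d_p\} \text{ (i.e. } |S\cap T|=p),\\ 0 & \text{if } S\ne T \text{ but } |S\cap T|>p,\end{cases}$$ where $\langle v,v_S\rangle$ denotes the coefficient of $v_S$ in the expansion of $v\in V_{n,m}$ in the basis $\{v_S : S\in\binom{[n+m]}{n}\}$.
   Context: Work over $\mathbb C$. Let $1\le m\le n$ and consider the two-column shape $2^m1^{n-m}$ (first column of length $n$, second of length $m$), with tableaux filled by distinct entries of $[n+m]$. Let $V_{n,m}$ be the vector space generated by such tableaux modulo the column relations $t+s$ ($s$ obtained from $t$ by switching two entries in the same column); $\bar t$ denotes the image of $t$. For an $n$-subset $S\subseteq[n+m]$, let $t_S$ be the tableau whose first column is $S$ in increasing order (top to bottom) and whose second column is $[n+m]\setminus S$ in increasing order, and $v_S:=\bar t_S$; the $v_S$ form a basis of $V_{n,m}$. Define $g_S:=v_S-\sum\bar t$, where the sum is over all tableaux $t$ obtained from $t_S$ by choosing an $m$-subset $S'\subseteq S$ and, for each $i=1,\dots,m$, exchanging the $i$-th smallest element of $S'$ (in column 1) with the $i$-th entry of column 2 of $t_S$. -}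

module Defs where

open import Data.Bool using (Bool; true; false; if_then_else_)
open import Data.Nat using (ℕ; zero; suc; _+_)
open import Data.Fin using (Fin; toℕ; _<?_)
open import Data.Fin.Properties using (_≟_)
open import Data.Fin.Subset using (Subset; ∁; ∣_∣; inside; outside)
open import Data.Fin.Subset.Properties using (_∈?_; _⊆?_)
open import Data.List using (List; []; _∷_; filter; length; map; allFin; concatMap)
open import Data.Bool.ListAction using (any)
open import Data.Vec using (Vec; []; _∷_; tabulate)
import Data.Vec.Properties as VecP
import Data.Bool.Properties as BoolP
open import Data.Integer using (ℤ; 0ℤ; 1ℤ; -_) renaming (_+_ to _+ℤ_; _-_ to _-ℤ_)
open import Relation.Nullary using (does)
open import Relation.Nullary.Decidable using (⌊_⌋)
open import Relation.Binary.PropositionalEquality using (_≡_)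

-- Entries of tableaux are the elements of [n+m], encoded as Fin (n + m)
-- (Fin value i stands for the number i+1).

elements : ∀ {N} → Subset N → List (Fin N)
elements {N} S = filter (λ i → i ∈? S) (allFin N)

toSubset : ∀ {N} → List (Fin N) → Subset N
toSubset xs = tabulate (λ i → any (λ y → does (i ≟ y)) xs)

_≟S_ : ∀ {N} (S T : Subset N) → Relation.Nullary.Dec (S ≡ T)
_≟S_ = VecP.≡-dec BoolP._≟_

allSubsets : (N : ℕ) → List (Subset N)
allSubsets zero = [] ∷ []
allSubsets (suc N) = concatMap (λ s → (outside ∷ s) ∷ (inside ∷ s) ∷ []) (allSubsets N)

inv : ∀ {N} → List (Fin N) → ℕ
inv [] = 0
inv (x ∷ xs) = length (filter (λ y → y <? x) xs) + inv xs

sgn : ℕ → ℤ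
sgn zero = 1ℤ
sgn (suc k) = - sgn k

-- Elements of V_{n,m}, represented by their coefficient vectors in the basis
-- {v_S}: a function from (n-)subsets to coefficients.
V : ℕ → Set
V N = Subset N → ℤ

⟨_,_⟩ : ∀ {N} → V N → Subset N → ℤ
⟨ v , T ⟩ = v T

_⊕_ : ∀ {N} → V N → V N → V N
(u ⊕ w) T = u T +ℤ w T

_⊖_ : ∀ {N} → V N → V N → V N
(u ⊖ w) T = u T -ℤ w T

zeroV : ∀ {N} → V N
zeroV T = 0ℤ

sumV : ∀ {N} → List (V N) → V N
sumV [] = zeroV
sumV (v ∷ vs) = v ⊕ sumV vs

-- A tableau of shape 2^m 1^(n-m): first column (top to bottom) and second column.
record Tableau (N : ℕ) : Set where
  constructor tab
  field
    col1 : List (Fin N)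
    col2 : List (Fin N)

-- Image t̄ of a tableau in V: by the column relations, t̄ = sign · v_S where S is
-- the entry set of column 1 and sign is the product of the signs of the
-- permutations sorting each column (entries are distinct).
bar : ∀ {N} → Tableau N → V N
bar (tab c1 c2) T =
  if does (toSubset c1 ≟S T) then sgn (inv c1 + inv c2) else 0ℤ

tS : ∀ {N} → Subset N → Tableau N
tS S = tab (elements S) (elements (∁ S))

vS : ∀ {N} → Subset N → V N
vS S = bar (tS S)

exchange : ∀ {N} → List (Fin N) → Subset N → List (Fin N) → List (Fin N)
exchange [] S' cs = []
exchange (x ∷ xs) S' cs with does (x ∈? S')
... | false = x ∷ exchange xs S' cs
exchange (x ∷ xs) S' [] | true = x ∷ exchange xs S' []
exchange (x ∷ xs) S' (c ∷ cs) | true = c ∷ exchange xs S' cs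

-- The tableau obtained from t_S by exchanging, for i = 1..m, the i-th smallest
-- element of S' (in column 1) with the i-th entry of column 2 of t_S.
tSwap : ∀ {N} → Subset N → Subset N → Tableau N
tSwap S S' = tab (exchange (elements S) S' (elements (∁ S))) (elements S')

mSubsetsOf : ∀ {N} → ℕ → Subset N → List (Subset N)
mSubsetsOf {N} m S =
  filter (λ S' → S' ⊆? S) (filter (λ S' → ∣ S' ∣ Data.Nat.≟ m) (allSubsets N))

g : (n m : ℕ) → Subset (n + m) → V (n + m)
g n m S = vS S ⊖ sumV (map (λ S' → bar (tSwap S S')) (mSubsetsOf m S))

{-# OPTIONS --safe #-}
module Submission where

-- By the column relations a tableau is ± v_X, X the entry set of its first column.
-- For S′ ⊆ S with |S′| = |∁ S| the first column of the exchanged tableau has entry set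
-- (S ∖ S′) ∪ ∁ S = ∁ S′, so the only term of g_S contributing to the coefficient of v_T is
-- S′ = ∁ T, and it occurs in the sum iff ∁ T ⊆ S, i.e. iff |S ∩ T| = n − m = p.
-- In that case the first column interleaves the sorted lists S ∩ T and ∁ S, the entries of ∁ S
-- taking the places of those of ∁ T. Modulo 2 its inversions are counted, for each d ∈ S ∩ T, by
-- the entries of ∁ T and of ∁ S below d, i.e. by d − 1 minus the rank of d in S ∩ T. Summing gives
-- Σ dᵢ − C(p + 1, 2), and g_S subtracts this tableau, whence the extra sign.

open import Defs

open import Data.Bool using (Bool; true; false; _∧_; _∨_)
import Data.Bool.Properties as Bool
open import Data.Bool.ListAction using (any)
open import Data.Fin as Fin using (Fin; zero; suc; toℕ; _<?_)
import Data.Fin.Properties as Fin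
open import Data.Fin.Subset using (Subset; ∣_∣; _∩_; ∁; _∈_; _∉_; _⊆_; inside; outside)
open import Data.Fin.Subset.Properties
  using ( _∈?_; _⊆?_; drop-there; drop-∷-⊆; in⊆in; out⊆; ∣p∩q∣≤∣q∣; x∈p∩q⁺; x∈p∩q⁻
        ; x∉p⇒x∈∁p; x∈∁p⇒x∉p; p⊆q⇒∁p⊇∁q; ∩-comm; ∩-idem; ∣∁p∣≡n∸∣p∣ )
open import Data.Integer using (0ℤ; 1ℤ; -_; _*_) renaming (_+_ to _+ℤ_; _-_ to _-ℤ_)
import Data.Integer.Properties as ℤ
open import Data.List using (List; []; _∷_; _++_; length; filter; map; allFin; tabulate; concatMap)
import Data.List.Properties as List
open import Data.List.Membership.Propositional.Properties using (∈-allFin)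
open import Data.List.Relation.Binary.Permutation.Propositional as Perm
  using (_↭_; ↭-refl; ↭-prep; ↭-sym; ↭-trans; module PermutationReasoning)
import Data.List.Relation.Binary.Permutation.Propositional.Properties as ↭
open import Data.List.Relation.Unary.All as All using (All; []; _∷_)
import Data.List.Relation.Unary.All.Properties as All
open import Data.List.Relation.Unary.AllPairs using (AllPairs; []; _∷_)
import Data.List.Relation.Unary.AllPairs.Properties as AllPairs
import Data.List.Relation.Unary.Any as Any
import Data.List.Relation.Unary.Any.Properties as Any
open import Data.Nat as ℕ using (ℕ; zero; suc; _+_; _∸_; _≤_; _<_)
open import Data.Nat.Combinatorics using (_C_; nC1≡n; nCk+nC[k+1]≡[n+1]C[k+1])
open import Data.Nat.ListAction using (sum)
import Data.Nat.Properties as ℕ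
open import Algebra.Properties.CommutativeSemigroup ℕ.+-commutativeSemigroup
  using (interchange; x∙yz≈y∙xz; xy∙z≈xz∙y; xy∙z≈x∙zy)
open import Data.Product using (_×_; _,_)
open import Data.Vec using ([]; _∷_; lookup; here; there)
import Data.Vec.Properties as Vec
open import Function using (id; _∘_)
open import Function.Bundles using (Equivalence)
open import Level using (Level)
open import Relation.Binary using (DecidableEquality; tri<; tri≈; tri>)
open import Relation.Binary.PropositionalEquality
  using (_≡_; _≢_; refl; sym; trans; cong; cong₂; subst; subst₂; module ≡-Reasoning)
open import Relation.Nullary using (yes; no; does; ¬_; ¬?; _×-dec_; contradiction)
open import Relation.Nullary.Decidable using (dec-true)
open import Relation.Unary using (Pred; Decidable)

private
  variable
    ℓ ℓ′ : Level
    A : Set ℓ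

sgn-+ : ∀ a b → sgn (a + b) ≡ sgn a * sgn b
sgn-+ zero    b = sym (ℤ.*-identityˡ (sgn b))
sgn-+ (suc a) b = trans (cong -_ (sgn-+ a b)) (ℤ.neg-distribˡ-* (sgn a) (sgn b))

sgn-double : ∀ k → sgn (k + k) ≡ 1ℤ
sgn-double zero    = refl
sgn-double (suc k) = begin
  - sgn (k + suc k)  ≡⟨ cong (-_ ∘ sgn) (ℕ.+-suc k k) ⟩
  - - sgn (k + k)    ≡⟨ ℤ.neg-involutive (sgn (k + k)) ⟩
  sgn (k + k)        ≡⟨ sgn-double k ⟩
  1ℤ                 ∎
  where open ≡-Reasoning

sgn-double-+ : ∀ k b → sgn ((k + k) + b) ≡ sgn b
sgn-double-+ k b = begin
  sgn ((k + k) + b)    ≡⟨ sgn-+ (k + k) b ⟩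
  sgn (k + k) * sgn b  ≡⟨ cong (_* sgn b) (sgn-double k) ⟩
  1ℤ * sgn b           ≡⟨ ℤ.*-identityˡ (sgn b) ⟩
  sgn b                ∎
  where open ≡-Reasoning

sgn-move : ∀ {a k b} l → a + k ≡ (l + l) + b → sgn a ≡ sgn (k + b)
sgn-move {a} {k} {b} l a+k≡2l+b = begin
  sgn a                      ≡⟨ ℤ.*-identityʳ (sgn a) ⟨
  sgn a * 1ℤ                 ≡⟨ cong (sgn a *_) (sgn-double k) ⟨
  sgn a * sgn (k + k)        ≡⟨ cong (sgn a *_) (sgn-+ k k) ⟩
  sgn a * (sgn k * sgn k)    ≡⟨ ℤ.*-assoc (sgn a) (sgn k) (sgn k) ⟨
  sgn a * sgn k * sgn k      ≡⟨ cong (_* sgn k) (sgn-+ a k) ⟨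
  sgn (a + k) * sgn k        ≡⟨ cong (λ x → sgn x * sgn k) a+k≡2l+b ⟩
  sgn ((l + l) + b) * sgn k  ≡⟨ cong (_* sgn k) (sgn-double-+ l b) ⟩
  sgn b * sgn k              ≡⟨ ℤ.*-comm (sgn b) (sgn k) ⟩
  sgn k * sgn b              ≡⟨ sgn-+ k b ⟨
  sgn (k + b)                ∎
  where open ≡-Reasoning

filter-map : ∀ {B : Set ℓ} {P : Pred B ℓ′} (P? : Decidable P) (f : A → B) xs →
  filter P? (map f xs) ≡ map f (filter (P? ∘ f) xs)
filter-map P? f []       = refl
filter-map P? f (x ∷ xs) with does (P? (f x))
... | true  = cong (f x ∷_) (filter-map P? f xs)
... | false = filter-map P? f xs

filter-filter : ∀ {P Q : Pred A ℓ′} (P? : Decidable P) (Q? : Decidable Q) xs →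
  filter P? (filter Q? xs) ≡ filter (λ x → Q? x ×-dec P? x) xs
filter-filter P? Q? []       = refl
filter-filter P? Q? (x ∷ xs) with does (Q? x)
... | false = filter-filter P? Q? xs
... | true with does (P? x)
...   | true  = cong (x ∷_) (filter-filter P? Q? xs)
...   | false = filter-filter P? Q? xs

filter-partition-↭ : ∀ {P : Pred A ℓ′} (P? : Decidable P) xs →
  xs ↭ filter P? xs ++ filter (λ x → ¬? (P? x)) xs
filter-partition-↭ P? []       = ↭-refl
filter-partition-↭ P? (x ∷ xs) with does (P? x)
... | true  = ↭-prep x (filter-partition-↭ P? xs)
... | false = ↭-trans (↭-prep x (filter-partition-↭ P? xs)) (↭-sym (↭.shift x (filter P? xs) _))

filter-tabulate-suc : ∀ {N} {P : Pred (Fin (suc N)) ℓ} {Q : Pred (Fin N) ℓ′}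
  (P? : Decidable P) (Q? : Decidable Q) → (∀ {i} → P (suc i) → Q i) → (∀ {i} → Q i → P (suc i)) →
  filter P? (tabulate Fin.suc) ≡ map Fin.suc (filter Q? (allFin N))
filter-tabulate-suc {N = N} P? Q? P⇒Q Q⇒P = begin
  filter P? (tabulate Fin.suc)
    ≡⟨ cong (filter P?) (List.map-tabulate id Fin.suc) ⟨
  filter P? (map Fin.suc (allFin N))
    ≡⟨ filter-map P? Fin.suc (allFin N) ⟩
  map Fin.suc (filter (P? ∘ Fin.suc) (allFin N))
    ≡⟨ cong (map Fin.suc) (List.filter-≐ (P? ∘ Fin.suc) Q? (P⇒Q , Q⇒P) (allFin N)) ⟩
  map Fin.suc (filter Q? (allFin N)) ∎
  where open ≡-Reasoning

any-↭ : ∀ (f : A → Bool) {xs ys} → xs ↭ ys → any f xs ≡ any f ys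
any-↭ f Perm.refl       = refl
any-↭ f (Perm.prep x p) = cong (f x ∨_) (any-↭ f p)
any-↭ f (Perm.swap {xs} {ys} x y p) = begin
  f x ∨ (f y ∨ any f xs)  ≡⟨ Bool.∨-assoc (f x) (f y) (any f xs) ⟨
  (f x ∨ f y) ∨ any f xs  ≡⟨ cong₂ _∨_ (Bool.∨-comm (f x) (f y)) (any-↭ f p) ⟩
  (f y ∨ f x) ∨ any f ys  ≡⟨ Bool.∨-assoc (f y) (f x) (any f ys) ⟩
  f y ∨ (f x ∨ any f ys)  ∎
  where open ≡-Reasoning
any-↭ f (Perm.trans p q) = trans (any-↭ f p) (any-↭ f q)

sum-map-suc : ∀ (f : A → ℕ) xs → sum (map (suc ∘ f) xs) ≡ length xs + sum (map f xs)
sum-map-suc f []       = refl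
sum-map-suc f (x ∷ xs) =
  cong suc (trans (cong (f x +_) (sum-map-suc f xs)) (x∙yz≈y∙xz (f x) (length xs) (sum (map f xs))))

-- Counting entries below a given one

module _ {N : ℕ} where

  Sorted : List (Fin N) → Set
  Sorted = AllPairs Fin._<_

  countBelow : Fin N → List (Fin N) → ℕ
  countBelow d xs = length (filter (_<? d) xs)

  countBelow-accept : ∀ {d x} xs → x Fin.< d → countBelow d (x ∷ xs) ≡ suc (countBelow d xs)
  countBelow-accept xs x<d = cong length (List.filter-accept (_<? _) x<d)

  countBelow-reject : ∀ {d x} xs → ¬ x Fin.< d → countBelow d (x ∷ xs) ≡ countBelow d xs
  countBelow-reject xs x≮d = cong length (List.filter-reject (_<? _) x≮d)

  countBelow-above : ∀ {d xs} → All (d Fin.<_) xs → countBelow d xs ≡ 0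
  countBelow-above d<xs = cong length (List.filter-none (_<? _) (All.map Fin.<-asym d<xs))

  countBelow-++ : ∀ d xs ys → countBelow d (xs ++ ys) ≡ countBelow d xs + countBelow d ys
  countBelow-++ d xs ys =
    trans (cong length (List.filter-++ (_<? d) xs ys)) (List.length-++ (filter (_<? d) xs))

  countBelow-↭ : ∀ d {xs ys} → xs ↭ ys → countBelow d xs ≡ countBelow d ys
  countBelow-↭ d xs↭ys = ↭.↭-length (↭.filter-↭ (_<? d) xs↭ys)

  countBelow-∷-flip : ∀ {c d} xs ys → c ≢ d →
    countBelow d (c ∷ xs) + countBelow c (d ∷ ys) ≡ suc (countBelow d xs + countBelow c ys)
  countBelow-∷-flip {c} {d} xs ys c≢d with Fin.<-cmp c d
  ... | tri< c<d _ _ rewrite countBelow-accept xs c<d | countBelow-reject ys (Fin.<-asym c<d) = refl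
  ... | tri≈ _ c≡d _ = contradiction c≡d c≢d
  ... | tri> _ _ d<c rewrite countBelow-reject xs (Fin.<-asym d<c) | countBelow-accept ys d<c =
    ℕ.+-suc (countBelow d xs) (countBelow c ys)

  inv-sorted : ∀ {xs} → Sorted xs → inv xs ≡ 0
  inv-sorted []                = refl
  inv-sorted (x<xs ∷ xs-sorted) = cong₂ _+_ (countBelow-above x<xs) (inv-sorted xs-sorted)

countBelow-zero : ∀ {N} (xs : List (Fin (suc N))) → countBelow zero xs ≡ 0
countBelow-zero {N} xs = cong length (List.filter-none (_<? zero {N}) (All.universal (λ _ ()) xs))

countBelow-allFin : ∀ {N} (d : Fin N) → countBelow d (allFin N) ≡ toℕ d
countBelow-allFin {suc N} zero    = countBelow-zero (allFin (suc N))
countBelow-allFin {suc N} (suc d) = cong suc (begin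
  countBelow (suc d) (tabulate Fin.suc)
    ≡⟨ cong length (filter-tabulate-suc {N = N} (_<? suc d) (_<? d) ℕ.s<s⁻¹ ℕ.s<s) ⟩
  length (map Fin.suc (filter (_<? d) (allFin N)))
    ≡⟨ List.length-map Fin.suc (filter (_<? d) (allFin N)) ⟩
  countBelow d (allFin N)
    ≡⟨ countBelow-allFin d ⟩
  toℕ d ∎)
  where open ≡-Reasoning

n+nC2≡[1+n]C2 : ∀ n → n + n C 2 ≡ suc n C 2
n+nC2≡[1+n]C2 n = trans (cong (_+ n C 2) (sym (nC1≡n n))) (nCk+nC[k+1]≡[n+1]C[k+1] n 1)

module _ {N : ℕ} where

  pairsBelow : List (Fin N) → List (Fin N) → ℕ
  pairsBelow ys ds = sum (map (λ d → countBelow d ys) ds)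

  pairsBelow-↭ : ∀ {ys ys′} ds → ys ↭ ys′ → pairsBelow ys ds ≡ pairsBelow ys′ ds
  pairsBelow-↭ ds ys↭ys′ = cong sum (List.map-cong (λ d → countBelow-↭ d ys↭ys′) ds)

  pairsBelow-++ : ∀ xs ys ds → pairsBelow (xs ++ ys) ds ≡ pairsBelow xs ds + pairsBelow ys ds
  pairsBelow-++ xs ys []       = refl
  pairsBelow-++ xs ys (d ∷ ds) = begin
    countBelow d (xs ++ ys) + pairsBelow (xs ++ ys) ds
      ≡⟨ cong₂ _+_ (countBelow-++ d xs ys) (pairsBelow-++ xs ys ds) ⟩
    (countBelow d xs + countBelow d ys) + (pairsBelow xs ds + pairsBelow ys ds)
      ≡⟨ interchange (countBelow d xs) (countBelow d ys) (pairsBelow xs ds) (pairsBelow ys ds) ⟩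
    (countBelow d xs + pairsBelow xs ds) + (countBelow d ys + pairsBelow ys ds) ∎
    where open ≡-Reasoning

  pairsBelow-∷-min : ∀ {x} ys {ds} → All (x Fin.<_) ds →
    pairsBelow (x ∷ ys) ds ≡ length ds + pairsBelow ys ds
  pairsBelow-∷-min ys []                   = refl
  pairsBelow-∷-min ys {d ∷ ds} (x<d ∷ x<ds) = begin
    countBelow d (_ ∷ ys) + pairsBelow (_ ∷ ys) ds
      ≡⟨ cong₂ _+_ (countBelow-accept ys x<d) (pairsBelow-∷-min ys x<ds) ⟩
    suc (countBelow d ys + (length ds + pairsBelow ys ds))
      ≡⟨ cong suc (x∙yz≈y∙xz (countBelow d ys) (length ds) (pairsBelow ys ds)) ⟩
    suc (length ds + (countBelow d ys + pairsBelow ys ds)) ∎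
    where open ≡-Reasoning

  pairsBelow-∷ : ∀ {c} ys {ds} → All (c ≢_) ds →
    pairsBelow (c ∷ ys) ds + countBelow c ds ≡ length ds + pairsBelow ys ds
  pairsBelow-∷ ys []                        = refl
  pairsBelow-∷ {c} ys {d ∷ ds} (c≢d ∷ c∉ds) = begin
    (countBelow d (c ∷ ys) + pairsBelow (c ∷ ys) ds) + countBelow c (d ∷ ds)
      ≡⟨ xy∙z≈xz∙y (countBelow d (c ∷ ys)) (pairsBelow (c ∷ ys) ds) (countBelow c (d ∷ ds)) ⟩
    (countBelow d (c ∷ ys) + countBelow c (d ∷ ds)) + pairsBelow (c ∷ ys) ds
      ≡⟨ cong (_+ pairsBelow (c ∷ ys) ds) (countBelow-∷-flip ys ds c≢d) ⟩
    suc (countBelow d ys + countBelow c ds) + pairsBelow (c ∷ ys) ds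
      ≡⟨ cong suc (xy∙z≈x∙zy (countBelow d ys) (countBelow c ds) (pairsBelow (c ∷ ys) ds)) ⟩
    suc (countBelow d ys + (pairsBelow (c ∷ ys) ds + countBelow c ds))
      ≡⟨ cong (λ k → suc (countBelow d ys + k)) (pairsBelow-∷ ys c∉ds) ⟩
    suc (countBelow d ys + (length ds + pairsBelow ys ds))
      ≡⟨ cong suc (x∙yz≈y∙xz (countBelow d ys) (length ds) (pairsBelow ys ds)) ⟩
    suc (length ds + (countBelow d ys + pairsBelow ys ds)) ∎
    where open ≡-Reasoning

  sgn-pairsBelow-replace : ∀ {x c} ys zs {ds} → All (x Fin.<_) ds → All (c ≢_) ds →
    sgn (pairsBelow (x ∷ ys ++ c ∷ zs) ds) ≡ sgn (countBelow c ds + pairsBelow (ys ++ zs) ds)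
  sgn-pairsBelow-replace {x} {c} ys zs {ds} x<ds c∉ds =
    sgn-move {pairsBelow (x ∷ ys ++ c ∷ zs) ds} {countBelow c ds} {P} L (begin
      pairsBelow (x ∷ ys ++ c ∷ zs) ds + countBelow c ds
        ≡⟨ cong (_+ countBelow c ds) (pairsBelow-∷-min (ys ++ c ∷ zs) x<ds) ⟩
      L + pairsBelow (ys ++ c ∷ zs) ds + countBelow c ds
        ≡⟨ cong (λ k → L + k + countBelow c ds) (pairsBelow-↭ ds (↭.shift c ys zs)) ⟩
      L + pairsBelow (c ∷ ys ++ zs) ds + countBelow c ds
        ≡⟨ ℕ.+-assoc L (pairsBelow (c ∷ ys ++ zs) ds) (countBelow c ds) ⟩
      L + (pairsBelow (c ∷ ys ++ zs) ds + countBelow c ds)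
        ≡⟨ cong (L +_) (pairsBelow-∷ (ys ++ zs) c∉ds) ⟩
      L + (L + P)
        ≡⟨ ℕ.+-assoc L L P ⟨
      (L + L) + P ∎)
    where
    open ≡-Reasoning
    L = length ds
    P = pairsBelow (ys ++ zs) ds

  pairsBelow-sorted : ∀ {ds} → Sorted ds → pairsBelow ds ds ≡ length ds C 2
  pairsBelow-sorted []                       = refl
  pairsBelow-sorted {d ∷ ds} (d<ds ∷ ds-sorted) = begin
    countBelow d (d ∷ ds) + pairsBelow (d ∷ ds) ds
      ≡⟨ cong₂ _+_ (trans (countBelow-reject ds (Fin.<-irrefl refl)) (countBelow-above d<ds))
                   (pairsBelow-∷-min ds d<ds) ⟩
    length ds + pairsBelow ds ds  ≡⟨ cong (length ds +_) (pairsBelow-sorted ds-sorted) ⟩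
    length ds + length ds C 2     ≡⟨ n+nC2≡[1+n]C2 (length ds) ⟩
    suc (length ds) C 2           ∎
    where open ≡-Reasoning

pairsBelow-allFin : ∀ {N} ds → pairsBelow (allFin N) ds ≡ sum (map toℕ ds)
pairsBelow-allFin ds = cong sum (List.map-cong countBelow-allFin ds)

does-∈? : ∀ {N} (i : Fin N) (X : Subset N) → does (i ∈? X) ≡ lookup X i
does-∈? zero    (inside  ∷ X) = refl
does-∈? zero    (outside ∷ X) = refl
does-∈? (suc i) (b ∷ X)       = does-∈? i X

∁-involutive : ∀ {N} (X : Subset N) → ∁ (∁ X) ≡ X
∁-involutive []      = refl
∁-involutive (b ∷ X) = cong₂ _∷_ (Bool.not-involutive b) (∁-involutive X)

q⊆p⇒p∩q≡q : ∀ {N} {p q : Subset N} → q ⊆ p → p ∩ q ≡ q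
q⊆p⇒p∩q≡q {p = []}          {[]}          _   = refl
q⊆p⇒p∩q≡q {p = s ∷ p}       {outside ∷ q} q⊆p = cong₂ _∷_ (Bool.∧-zeroʳ s) (q⊆p⇒p∩q≡q (drop-∷-⊆ q⊆p))
q⊆p⇒p∩q≡q {p = inside ∷ p}  {inside ∷ q}  q⊆p = cong (inside ∷_) (q⊆p⇒p∩q≡q (drop-∷-⊆ q⊆p))
q⊆p⇒p∩q≡q {p = outside ∷ p} {inside ∷ q}  q⊆p = contradiction (q⊆p here) λ ()

∣p∩q∣≡∣q∣⇒q⊆p : ∀ {N} (p q : Subset N) → ∣ p ∩ q ∣ ≡ ∣ q ∣ → q ⊆ p
∣p∩q∣≡∣q∣⇒q⊆p []            []            _ = λ ()
∣p∩q∣≡∣q∣⇒q⊆p (inside ∷ p)  (inside ∷ q)  e = in⊆in (∣p∩q∣≡∣q∣⇒q⊆p p q (ℕ.suc-injective e))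
∣p∩q∣≡∣q∣⇒q⊆p (outside ∷ p) (inside ∷ q)  e = contradiction (subst (_≤ ∣ q ∣) e (∣p∩q∣≤∣q∣ p q)) ℕ.1+n≰n
∣p∩q∣≡∣q∣⇒q⊆p (inside ∷ p)  (outside ∷ q) e = out⊆ (∣p∩q∣≡∣q∣⇒q⊆p p q e)
∣p∩q∣≡∣q∣⇒q⊆p (outside ∷ p) (outside ∷ q) e = out⊆ (∣p∩q∣≡∣q∣⇒q⊆p p q e)

elements-∷ : ∀ {N} b (X : Subset N) → filter (_∈? b ∷ X) (tabulate Fin.suc) ≡ map Fin.suc (elements X)
elements-∷ b X = filter-tabulate-suc (_∈? b ∷ X) (_∈? X) drop-there there

length-elements : ∀ {N} (X : Subset N) → length (elements X) ≡ ∣ X ∣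
length-elements []            = refl
length-elements (inside ∷ X)  = cong suc (trans (cong length (elements-∷ inside X))
  (trans (List.length-map Fin.suc (elements X)) (length-elements X)))
length-elements (outside ∷ X) = trans (cong length (elements-∷ outside X))
  (trans (List.length-map Fin.suc (elements X)) (length-elements X))

module _ {N : ℕ} where

  elements-sorted : (X : Subset N) → Sorted (elements X)
  elements-sorted X = AllPairs.filter⁺ (_∈? X) (AllPairs.tabulate⁺-< id)

  elements-⊆ : (X : Subset N) → All (_∈ X) (elements X)
  elements-⊆ X = All.all-filter (_∈? X) (allFin N)

  filter-∈-elements : (X Y : Subset N) → filter (_∈? Y) (elements X) ≡ elements (X ∩ Y)
  filter-∈-elements X Y = trans (filter-filter (_∈? Y) (_∈? X) (allFin N))
    (List.filter-≐ _ (_∈? X ∩ Y) (x∈p∩q⁺ , x∈p∩q⁻ X Y) (allFin N))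

  filter-∉-elements : (X Y : Subset N) → filter (λ i → ¬? (i ∈? Y)) (elements X) ≡ elements (X ∩ ∁ Y)
  filter-∉-elements X Y = trans (filter-filter (λ i → ¬? (i ∈? Y)) (_∈? X) (allFin N))
    (List.filter-≐ _ (_∈? X ∩ ∁ Y) (to , from) (allFin N))
    where
    to : ∀ {i} → i ∈ X × i ∉ Y → i ∈ X ∩ ∁ Y
    to (i∈X , i∉Y) = x∈p∩q⁺ (i∈X , x∉p⇒x∈∁p i∉Y)
    from : ∀ {i} → i ∈ X ∩ ∁ Y → i ∈ X × i ∉ Y
    from i∈X∩∁Y with x∈p∩q⁻ X (∁ Y) i∈X∩∁Y
    ... | i∈X , i∈∁Y = i∈X , x∈∁p⇒x∉p i∈∁Y

  elements-split : (X Y : Subset N) → elements X ↭ elements (X ∩ Y) ++ elements (X ∩ ∁ Y)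
  elements-split X Y = subst (elements X ↭_)
    (cong₂ _++_ (filter-∈-elements X Y) (filter-∉-elements X Y))
    (filter-partition-↭ (_∈? Y) (elements X))

  allFin-split : (X : Subset N) → allFin N ↭ elements X ++ elements (∁ X)
  allFin-split X = subst (allFin N ↭_)
    (cong (elements X ++_) (List.filter-≐ _ (_∈? ∁ X) (x∉p⇒x∈∁p , x∈∁p⇒x∉p) (allFin N)))
    (filter-partition-↭ (_∈? X) (allFin N))

  ∣p∩q∣+∣p∩∁q∣≡∣p∣ : ∀ (p q : Subset N) → ∣ p ∩ q ∣ + ∣ p ∩ ∁ q ∣ ≡ ∣ p ∣
  ∣p∩q∣+∣p∩∁q∣≡∣p∣ p q = begin
    ∣ p ∩ q ∣ + ∣ p ∩ ∁ q ∣
      ≡⟨ cong₂ _+_ (length-elements (p ∩ q)) (length-elements (p ∩ ∁ q)) ⟨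
    length (elements (p ∩ q)) + length (elements (p ∩ ∁ q))
      ≡⟨ List.length-++ (elements (p ∩ q)) ⟨
    length (elements (p ∩ q) ++ elements (p ∩ ∁ q))
      ≡⟨ ↭.↭-length (elements-split p q) ⟨
    length (elements p)
      ≡⟨ length-elements p ⟩
    ∣ p ∣ ∎
    where open ≡-Reasoning

  ∁q⊆p⇒∣p∩q∣+∣∁q∣≡∣p∣ : ∀ (p q : Subset N) → ∁ q ⊆ p → ∣ p ∩ q ∣ + ∣ ∁ q ∣ ≡ ∣ p ∣
  ∁q⊆p⇒∣p∩q∣+∣∁q∣≡∣p∣ p q ∁q⊆p =
    trans (cong (λ X → ∣ p ∩ q ∣ + ∣ X ∣) (sym (q⊆p⇒p∩q≡q ∁q⊆p))) (∣p∩q∣+∣p∩∁q∣≡∣p∣ p q)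

  ∣p∩q∣+∣∁q∣≡∣p∣⇒∁q⊆p : ∀ (p q : Subset N) → ∣ p ∩ q ∣ + ∣ ∁ q ∣ ≡ ∣ p ∣ → ∁ q ⊆ p
  ∣p∩q∣+∣∁q∣≡∣p∣⇒∁q⊆p p q eq = ∣p∩q∣≡∣q∣⇒q⊆p p (∁ q)
    (ℕ.+-cancelˡ-≡ ∣ p ∩ q ∣ _ _ (trans (∣p∩q∣+∣p∩∁q∣≡∣p∣ p q) (sym eq)))

  any-≟-filter : ∀ {P : Pred (Fin N) ℓ} (P? : Decidable P) i xs →
    any (λ y → does (i Fin.≟ y)) (filter P? xs) ≡ does (P? i) ∧ any (λ y → does (i Fin.≟ y)) xs
  any-≟-filter P? i []       = sym (Bool.∧-zeroʳ (does (P? i)))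
  any-≟-filter P? i (x ∷ xs) with does (P? x) in P?x
  ... | true with i Fin.≟ x
  ...   | yes refl rewrite P?x = refl
  ...   | no _     = any-≟-filter P? i xs
  any-≟-filter P? i (x ∷ xs) | false with i Fin.≟ x
  ...   | yes refl rewrite any-≟-filter P? i xs | P?x = refl
  ...   | no _     = any-≟-filter P? i xs

  any-≟-allFin : ∀ i → any (λ y → does (i Fin.≟ y)) (allFin N) ≡ true
  any-≟-allFin i = Equivalence.to Bool.T-≡ (Any.any⁺ (λ y → does (i Fin.≟ y))
    (Any.map (λ {y} i≡y → Equivalence.from Bool.T-≡ (dec-true (i Fin.≟ y) i≡y)) (∈-allFin i)))

  toSubset-elements : (X : Subset N) → toSubset (elements X) ≡ X
  toSubset-elements X = trans (Vec.tabulate-cong λ i → begin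
    any (λ y → does (i Fin.≟ y)) (filter (_∈? X) (allFin N))  ≡⟨ any-≟-filter (_∈? X) i (allFin N) ⟩
    does (i ∈? X) ∧ any (λ y → does (i Fin.≟ y)) (allFin N)  ≡⟨ cong₂ _∧_ (does-∈? i X) (any-≟-allFin i) ⟩
    lookup X i ∧ true                                        ≡⟨ Bool.∧-identityʳ (lookup X i) ⟩
    lookup X i                                               ∎)
    (Vec.tabulate∘lookup X)
    where open ≡-Reasoning

  toSubset-↭ : ∀ {xs ys : List (Fin N)} → xs ↭ ys → toSubset xs ≡ toSubset ys
  toSubset-↭ xs↭ys = Vec.tabulate-cong λ i → any-↭ (λ y → does (i Fin.≟ y)) xs↭ys

-- Exchanging entries of a column

module Exchange {N : ℕ} (S′ : Subset N) where

  replaced kept : List (Fin N) → List (Fin N)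
  replaced = filter (_∈? S′)
  kept     = filter (λ x → ¬? (x ∈? S′))

  exchange-↭ : ∀ xs cs → length cs ≡ length (replaced xs) → exchange xs S′ cs ↭ kept xs ++ cs
  exchange-↭ []       []       _   = ↭-refl
  exchange-↭ (x ∷ xs) cs       len with does (x ∈? S′)
  ... | false = ↭-prep x (exchange-↭ xs cs len)
  exchange-↭ (x ∷ xs) (c ∷ cs) len | true =
    ↭-trans (↭-prep c (exchange-↭ xs cs (ℕ.suc-injective len))) (↭-sym (↭.shift c (kept xs) cs))

  countBelow-exchange : ∀ d xs cs → length cs ≡ length (replaced xs) →
    countBelow d (exchange xs S′ cs) ≡ countBelow d (kept xs) + countBelow d cs
  countBelow-exchange d xs cs len =
    trans (countBelow-↭ d (exchange-↭ xs cs len)) (countBelow-++ d (kept xs) cs)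

  countBelow-exchange-kept : ∀ {x} xs cs → All (x Fin.<_) xs → length cs ≡ length (replaced xs) →
    countBelow x (exchange xs S′ cs) ≡ countBelow x (replaced xs ++ cs)
  countBelow-exchange-kept {x} xs cs x<xs len = begin
    countBelow x (exchange xs S′ cs)              ≡⟨ countBelow-exchange x xs cs len ⟩
    countBelow x (kept xs) + countBelow x cs      ≡⟨ cong (_+ countBelow x cs) (trans
                                                       (countBelow-above (All.filter⁺ _ x<xs))
                                                       (sym (countBelow-above (All.filter⁺ _ x<xs)))) ⟩
    countBelow x (replaced xs) + countBelow x cs  ≡⟨ countBelow-++ x (replaced xs) cs ⟨
    countBelow x (replaced xs ++ cs)              ∎
    where open ≡-Reasoning

  countBelow-exchange-inserted : ∀ {c} xs cs → All (c Fin.<_) cs → length cs ≡ length (replaced xs) →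
    countBelow c (exchange xs S′ cs) ≡ countBelow c (kept xs)
  countBelow-exchange-inserted {c} xs cs c<cs len = begin
    countBelow c (exchange xs S′ cs)          ≡⟨ countBelow-exchange c xs cs len ⟩
    countBelow c (kept xs) + countBelow c cs  ≡⟨ cong (countBelow c (kept xs) +_) (countBelow-above c<cs) ⟩
    countBelow c (kept xs) + 0                ≡⟨ ℕ.+-identityʳ (countBelow c (kept xs)) ⟩
    countBelow c (kept xs)                    ∎
    where open ≡-Reasoning

  -- A kept entry d and an inserted entry c form an inversion iff exactly one of "c < d" and
  -- "c sits before d" holds, and c sits before d iff the entry it replaced is below d.
  inv-exchange : ∀ {U} xs cs → Sorted xs → Sorted cs → All (_∈ U) xs → All (_∉ U) cs →
    length cs ≡ length (replaced xs) →
    sgn (inv (exchange xs S′ cs)) ≡ sgn (pairsBelow (replaced xs ++ cs) (kept xs))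
  inv-exchange []       []       _ _ _ _ _ = refl
  inv-exchange (x ∷ xs) cs (x<xs ∷ xs↑) cs↑ (_ ∷ xs⊆U) cs∉U len with does (x ∈? S′)
  ... | false = begin
    sgn (countBelow x E + inv E)
      ≡⟨ cong (λ k → sgn (k + inv E)) (countBelow-exchange-kept xs cs x<xs len) ⟩
    sgn (countBelow x Y + inv E)
      ≡⟨ sgn-+ (countBelow x Y) (inv E) ⟩
    sgn (countBelow x Y) * sgn (inv E)
      ≡⟨ cong (sgn (countBelow x Y) *_) (inv-exchange xs cs xs↑ cs↑ xs⊆U cs∉U len) ⟩
    sgn (countBelow x Y) * sgn (P Y)
      ≡⟨ sgn-+ (countBelow x Y) (P Y) ⟨
    sgn (countBelow x Y + P Y) ∎
    where
    open ≡-Reasoning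
    E = exchange xs S′ cs
    Y = replaced xs ++ cs
    P = λ ys → pairsBelow ys (kept xs)
  inv-exchange {U} (x ∷ xs) (c ∷ cs) (x<xs ∷ xs↑) (c<cs ∷ cs↑) (_ ∷ xs⊆U) (c∉U ∷ cs∉U) len
    | true = begin
    sgn (countBelow c E + inv E)
      ≡⟨ cong (λ k → sgn (k + inv E)) (countBelow-exchange-inserted xs cs c<cs len′) ⟩
    sgn (countBelow c K + inv E)
      ≡⟨ sgn-+ (countBelow c K) (inv E) ⟩
    sgn (countBelow c K) * sgn (inv E)
      ≡⟨ cong (sgn (countBelow c K) *_) (inv-exchange xs cs xs↑ cs↑ xs⊆U cs∉U len′) ⟩
    sgn (countBelow c K) * sgn (P (R ++ cs))
      ≡⟨ sgn-+ (countBelow c K) (P (R ++ cs)) ⟨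
    sgn (countBelow c K + P (R ++ cs))
      ≡⟨ sgn-pairsBelow-replace R cs (All.filter⁺ _ x<xs) c∉K ⟨
    sgn (P (x ∷ R ++ c ∷ cs)) ∎
    where
    open ≡-Reasoning
    E = exchange xs S′ cs
    R = replaced xs
    K = kept xs
    P = λ ys → pairsBelow ys K
    len′ = ℕ.suc-injective len
    c∉K : All (c ≢_) K
    c∉K = All.map (λ d∈U c≡d → c∉U (subst (_∈ U) (sym c≡d) d∈U)) (All.filter⁺ _ xs⊆U)

module _ {M : ℕ} (T : Subset M) where

  sumV-map-filter-vanishing : ∀ {P : Pred A ℓ′} (P? : Decidable P) (f : A → V M) xs →
    (∀ x → P x → f x T ≡ 0ℤ) → sumV (map f (filter P? xs)) T ≡ 0ℤ
  sumV-map-filter-vanishing P? f []       _   = refl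
  sumV-map-filter-vanishing P? f (x ∷ xs) f≡0 with P? x
  ... | yes Px = cong₂ _+ℤ_ (f≡0 x Px) (sumV-map-filter-vanishing P? f xs f≡0)
  ... | no  _  = sumV-map-filter-vanishing P? f xs f≡0

  sumV-map-filter-concentrated : ∀ {P : Pred A ℓ′} (_≟_ : DecidableEquality A) (P? : Decidable P)
    (f : A → V M) {x₀} → P x₀ → (∀ x → P x → x ≢ x₀ → f x T ≡ 0ℤ) →
    ∀ xs → sumV (map f (filter P? xs)) T ≡ sumV (map f (filter (_≟ x₀) xs)) T
  sumV-map-filter-concentrated _≟_ P? f {x₀} Px₀ f≡0 []       = refl
  sumV-map-filter-concentrated _≟_ P? f {x₀} Px₀ f≡0 (x ∷ xs) with x ≟ x₀
  ... | yes refl with P? x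
  ...   | yes _   = cong (f x T +ℤ_) (sumV-map-filter-concentrated _≟_ P? f Px₀ f≡0 xs)
  ...   | no ¬Px₀ = contradiction Px₀ ¬Px₀
  sumV-map-filter-concentrated _≟_ P? f Px₀ f≡0 (x ∷ xs) | no x≢x₀ with P? x
  ...   | yes Px = trans (cong₂ _+ℤ_ (f≡0 x Px x≢x₀) (sumV-map-filter-concentrated _≟_ P? f Px₀ f≡0 xs))
                         (ℤ.+-identityˡ _)
  ...   | no  _  = sumV-map-filter-concentrated _≟_ P? f Px₀ f≡0 xs

filter-≟-concatMap : ∀ {N} b (X : Subset N) Ys →
  filter (_≟S (b ∷ X)) (concatMap (λ s → (outside ∷ s) ∷ (inside ∷ s) ∷ []) Ys)
    ≡ map (b ∷_) (filter (_≟S X) Ys)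
filter-≟-concatMap b       X []       = refl
filter-≟-concatMap outside X (Y ∷ Ys) with Y ≟S X
... | yes _ = cong (_ ∷_) (filter-≟-concatMap outside X Ys)
... | no  _ = filter-≟-concatMap outside X Ys
filter-≟-concatMap inside  X (Y ∷ Ys) with Y ≟S X
... | yes _ = cong (_ ∷_) (filter-≟-concatMap inside X Ys)
... | no  _ = filter-≟-concatMap inside X Ys

filter-≟-allSubsets : ∀ {N} (X : Subset N) → filter (_≟S X) (allSubsets N) ≡ X ∷ []
filter-≟-allSubsets []      = refl
filter-≟-allSubsets (b ∷ X) =
  trans (filter-≟-concatMap b X (allSubsets _)) (cong (map (b ∷_)) (filter-≟-allSubsets X))

-- Tableaux

module _ {N : ℕ} where

  bar-≡ : ∀ c₁ c₂ {T : Subset N} → toSubset c₁ ≡ T → bar (tab c₁ c₂) T ≡ sgn (inv c₁ + inv c₂)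
  bar-≡ c₁ c₂ {T} c₁≡T with toSubset c₁ ≟S T
  ... | yes _   = refl
  ... | no c₁≢T = contradiction c₁≡T c₁≢T

  bar-≢ : ∀ c₁ c₂ {T : Subset N} → toSubset c₁ ≢ T → bar (tab c₁ c₂) T ≡ 0ℤ
  bar-≢ c₁ c₂ {T} c₁≢T with toSubset c₁ ≟S T
  ... | yes c₁≡T = contradiction c₁≡T c₁≢T
  ... | no  _    = refl

  vS-self : (S : Subset N) → vS S S ≡ 1ℤ
  vS-self S = trans (bar-≡ (elements S) (elements (∁ S)) (toSubset-elements S))
    (cong sgn (cong₂ _+_ (inv-sorted (elements-sorted S)) (inv-sorted (elements-sorted (∁ S)))))

  vS-≢ : ∀ {S T : Subset N} → S ≢ T → vS S T ≡ 0ℤ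
  vS-≢ {S} S≢T = bar-≢ (elements S) (elements (∁ S)) (λ S≡T → S≢T (trans (sym (toSubset-elements S)) S≡T))

module _ {N : ℕ} (S : Subset N) where

  open Exchange using (replaced; kept; exchange-↭; inv-exchange)

  replaced-elements : ∀ {S′} → S′ ⊆ S → replaced S′ (elements S) ≡ elements S′
  replaced-elements {S′} S′⊆S = trans (filter-∈-elements S S′) (cong elements (q⊆p⇒p∩q≡q S′⊆S))

  length-replaced : ∀ {S′} → S′ ⊆ S → ∣ S′ ∣ ≡ ∣ ∁ S ∣ →
    length (elements (∁ S)) ≡ length (replaced S′ (elements S))
  length-replaced {S′} S′⊆S ∣S′∣≡∣∁S∣ = begin
    length (elements (∁ S))            ≡⟨ length-elements (∁ S) ⟩
    ∣ ∁ S ∣                            ≡⟨ ∣S′∣≡∣∁S∣ ⟨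
    ∣ S′ ∣                             ≡⟨ length-elements S′ ⟨
    length (elements S′)               ≡⟨ cong length (replaced-elements S′⊆S) ⟨
    length (replaced S′ (elements S))  ∎
    where open ≡-Reasoning

  toSubset-exchange : ∀ {S′} → S′ ⊆ S → ∣ S′ ∣ ≡ ∣ ∁ S ∣ →
    toSubset (exchange (elements S) S′ (elements (∁ S))) ≡ ∁ S′
  toSubset-exchange {S′} S′⊆S ∣S′∣≡∣∁S∣ = begin
    toSubset (exchange (elements S) S′ (elements (∁ S)))
      ≡⟨ toSubset-↭ (exchange-↭ S′ (elements S) (elements (∁ S)) (length-replaced S′⊆S ∣S′∣≡∣∁S∣)) ⟩
    toSubset (kept S′ (elements S) ++ elements (∁ S))
      ≡⟨ cong (λ ks → toSubset (ks ++ elements (∁ S))) (filter-∉-elements S S′) ⟩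
    toSubset (elements (S ∩ ∁ S′) ++ elements (∁ S))
      ≡⟨ toSubset-↭ ∁S′-split ⟨
    toSubset (elements (∁ S′))
      ≡⟨ toSubset-elements (∁ S′) ⟩
    ∁ S′ ∎
    where
    open ≡-Reasoning
    ∁S′-split : elements (∁ S′) ↭ elements (S ∩ ∁ S′) ++ elements (∁ S)
    ∁S′-split = subst₂ (λ X Y → elements (∁ S′) ↭ elements X ++ elements Y)
      (∩-comm (∁ S′) S) (q⊆p⇒p∩q≡q (p⊆q⇒∁p⊇∁q S′⊆S)) (elements-split (∁ S′) S)

  bar-tSwap-≢ : ∀ {S′ T} → S′ ⊆ S → ∣ S′ ∣ ≡ ∣ ∁ S ∣ → S′ ≢ ∁ T → bar (tSwap S S′) T ≡ 0ℤ
  bar-tSwap-≢ {S′} S′⊆S ∣S′∣≡∣∁S∣ S′≢∁T =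
    bar-≢ (exchange (elements S) S′ (elements (∁ S))) (elements S′) λ ∁S′≡T →
      S′≢∁T (trans (sym (∁-involutive S′)) (cong ∁ (trans (sym (toSubset-exchange S′⊆S ∣S′∣≡∣∁S∣)) ∁S′≡T)))

  bar-tSwap-∁ : ∀ {T} → ∁ T ⊆ S → ∣ ∁ T ∣ ≡ ∣ ∁ S ∣ →
    bar (tSwap S (∁ T)) T ≡ sgn (inv (exchange (elements S) (∁ T) (elements (∁ S))))
  bar-tSwap-∁ {T} ∁T⊆S ∣∁T∣≡∣∁S∣ = begin
    bar (tSwap S (∁ T)) T
      ≡⟨ bar-≡ c₁ (elements (∁ T)) (trans (toSubset-exchange ∁T⊆S ∣∁T∣≡∣∁S∣) (∁-involutive T)) ⟩
    sgn (inv c₁ + inv (elements (∁ T)))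
      ≡⟨ cong (λ k → sgn (inv c₁ + k)) (inv-sorted (elements-sorted (∁ T))) ⟩
    sgn (inv c₁ + 0)
      ≡⟨ cong sgn (ℕ.+-identityʳ (inv c₁)) ⟩
    sgn (inv c₁) ∎
    where
    open ≡-Reasoning
    c₁ = exchange (elements S) (∁ T) (elements (∁ S))

  allFin-split-∁⊆ : ∀ {T} → ∁ T ⊆ S → allFin N ↭ elements (S ∩ T) ++ elements (∁ T) ++ elements (∁ S)
  allFin-split-∁⊆ {T} ∁T⊆S = begin
    allFin N
      ↭⟨ allFin-split S ⟩
    elements S ++ elements (∁ S)
      ↭⟨ ↭.++⁺ʳ (elements (∁ S)) (elements-split S T) ⟩
    (elements (S ∩ T) ++ elements (S ∩ ∁ T)) ++ elements (∁ S)
      ≡⟨ cong (λ X → (elements (S ∩ T) ++ elements X) ++ elements (∁ S)) (q⊆p⇒p∩q≡q ∁T⊆S) ⟩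
    (elements (S ∩ T) ++ elements (∁ T)) ++ elements (∁ S)
      ≡⟨ List.++-assoc (elements (S ∩ T)) (elements (∁ T)) (elements (∁ S)) ⟩
    elements (S ∩ T) ++ elements (∁ T) ++ elements (∁ S) ∎
    where open PermutationReasoning

  sgn-exchange-∁ : ∀ {T} → ∁ T ⊆ S → ∣ ∁ T ∣ ≡ ∣ ∁ S ∣ →
    sgn (inv (exchange (elements S) (∁ T) (elements (∁ S))))
      ≡ sgn (sum (map (λ d → suc (toℕ d)) (elements (S ∩ T))) + suc ∣ S ∩ T ∣ C 2)
  sgn-exchange-∁ {T} ∁T⊆S ∣∁T∣≡∣∁S∣ = begin
    sgn (inv (exchange (elements S) (∁ T) (elements (∁ S))))
      ≡⟨ inv-exchange (∁ T) (elements S) (elements (∁ S)) (elements-sorted S) (elements-sorted (∁ S))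
           (elements-⊆ S) (All.map x∈∁p⇒x∉p (elements-⊆ (∁ S))) (length-replaced ∁T⊆S ∣∁T∣≡∣∁S∣) ⟩
    sgn (pairsBelow (replaced (∁ T) (elements S) ++ elements (∁ S)) (kept (∁ T) (elements S)))
      ≡⟨ cong₂ (λ R K → sgn (pairsBelow (R ++ elements (∁ S)) K)) (replaced-elements ∁T⊆S) kept≡D ⟩
    sgn (pairsBelow Y D)
      ≡⟨ sgn-double-+ B (pairsBelow Y D) ⟨
    sgn ((B + B) + pairsBelow Y D)
      ≡⟨ cong sgn (xy∙z≈xz∙y B (pairsBelow Y D) B) ⟨
    sgn ((B + pairsBelow Y D) + B)
      ≡⟨ cong (λ k → sgn (k + B)) sum-suc-toℕ ⟨
    sgn (sum (map (λ d → suc (toℕ d)) D) + B) ∎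
    where
    open ≡-Reasoning
    D = elements (S ∩ T)
    Y = elements (∁ T) ++ elements (∁ S)
    B = suc ∣ S ∩ T ∣ C 2

    kept≡D : kept (∁ T) (elements S) ≡ D
    kept≡D = trans (filter-∉-elements S (∁ T)) (cong (λ X → elements (S ∩ X)) (∁-involutive T))

    sum-suc-toℕ : sum (map (λ d → suc (toℕ d)) D) ≡ B + pairsBelow Y D
    sum-suc-toℕ = begin
      sum (map (λ d → suc (toℕ d)) D)
        ≡⟨ sum-map-suc toℕ D ⟩
      length D + sum (map toℕ D)
        ≡⟨ cong (length D +_) (pairsBelow-allFin D) ⟨
      length D + pairsBelow (allFin N) D
        ≡⟨ cong (length D +_) (pairsBelow-↭ D (allFin-split-∁⊆ ∁T⊆S)) ⟩
      length D + pairsBelow (D ++ Y) D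
        ≡⟨ cong (length D +_) (pairsBelow-++ D Y D) ⟩
      length D + (pairsBelow D D + pairsBelow Y D)
        ≡⟨ cong (λ k → length D + (k + pairsBelow Y D)) (pairsBelow-sorted (elements-sorted (S ∩ T))) ⟩
      length D + (length D C 2 + pairsBelow Y D)
        ≡⟨ ℕ.+-assoc (length D) (length D C 2) (pairsBelow Y D) ⟨
      (length D + length D C 2) + pairsBelow Y D
        ≡⟨ cong (_+ pairsBelow Y D) (n+nC2≡[1+n]C2 (length D)) ⟩
      suc (length D) C 2 + pairsBelow Y D
        ≡⟨ cong (λ k → suc k C 2 + pairsBelow Y D) (length-elements (S ∩ T)) ⟩
      B + pairsBelow Y D ∎

  mSubsetsOf-≡ : ∀ m → mSubsetsOf m S ≡ filter (λ S′ → (∣ S′ ∣ ℕ.≟ m) ×-dec (S′ ⊆? S)) (allSubsets N)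
  mSubsetsOf-≡ m = filter-filter (_⊆? S) (λ S′ → ∣ S′ ∣ ℕ.≟ m) (allSubsets N)

  sumV-tSwap-∁⊈ : ∀ {m T} → ∣ ∁ S ∣ ≡ m → ¬ (∁ T ⊆ S) →
    sumV (map (λ S′ → bar (tSwap S S′)) (mSubsetsOf m S)) T ≡ 0ℤ
  sumV-tSwap-∁⊈ {m} {T} ∣∁S∣≡m ∁T⊈S = trans
    (cong (λ Ss → sumV (map (λ S′ → bar (tSwap S S′)) Ss) T) (mSubsetsOf-≡ m))
    (sumV-map-filter-vanishing T _ (λ S′ → bar (tSwap S S′)) (allSubsets N) λ S′ (∣S′∣≡m , S′⊆S) →
      bar-tSwap-≢ S′⊆S (trans ∣S′∣≡m (sym ∣∁S∣≡m)) (λ S′≡∁T → ∁T⊈S (subst (_⊆ S) S′≡∁T S′⊆S)))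

  sumV-tSwap-∁⊆ : ∀ {m T} → ∣ ∁ S ∣ ≡ m → ∣ ∁ T ∣ ≡ m → ∁ T ⊆ S →
    sumV (map (λ S′ → bar (tSwap S S′)) (mSubsetsOf m S)) T
      ≡ sgn (inv (exchange (elements S) (∁ T) (elements (∁ S))))
  sumV-tSwap-∁⊆ {m} {T} ∣∁S∣≡m ∣∁T∣≡m ∁T⊆S = begin
    sumV (map f (mSubsetsOf m S)) T
      ≡⟨ cong (λ Ss → sumV (map f Ss) T) (mSubsetsOf-≡ m) ⟩
    sumV (map f (filter P? (allSubsets N))) T
      ≡⟨ sumV-map-filter-concentrated T _≟S_ P? f (∣∁T∣≡m , ∁T⊆S) vanishes (allSubsets N) ⟩
    sumV (map f (filter (_≟S ∁ T) (allSubsets N))) T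
      ≡⟨ cong (λ Ss → sumV (map f Ss) T) (filter-≟-allSubsets (∁ T)) ⟩
    bar (tSwap S (∁ T)) T +ℤ 0ℤ
      ≡⟨ ℤ.+-identityʳ _ ⟩
    bar (tSwap S (∁ T)) T
      ≡⟨ bar-tSwap-∁ ∁T⊆S (trans ∣∁T∣≡m (sym ∣∁S∣≡m)) ⟩
    sgn (inv (exchange (elements S) (∁ T) (elements (∁ S)))) ∎
    where
    open ≡-Reasoning
    f : Subset N → V N
    f S′ = bar (tSwap S S′)
    P? = λ S′ → (∣ S′ ∣ ℕ.≟ m) ×-dec (S′ ⊆? S)
    vanishes : ∀ S′ → ∣ S′ ∣ ≡ m × S′ ⊆ S → S′ ≢ ∁ T → f S′ T ≡ 0ℤ
    vanishes S′ (∣S′∣≡m , S′⊆S) = bar-tSwap-≢ S′⊆S (trans ∣S′∣≡m (sym ∣∁S∣≡m))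

module _ {n m : ℕ} (S T : Subset (n + m)) (∣∁S∣≡m : ∣ ∁ S ∣ ≡ m) where

  ⟨g⟩-∁⊈ : ¬ (∁ T ⊆ S) → ⟨ g n m S , T ⟩ ≡ vS S T
  ⟨g⟩-∁⊈ ∁T⊈S = trans (cong (vS S T -ℤ_) (sumV-tSwap-∁⊈ S ∣∁S∣≡m ∁T⊈S)) (ℤ.+-identityʳ (vS S T))

  ⟨g⟩-∁⊆ : ∣ ∁ T ∣ ≡ m → ∁ T ⊆ S → S ≢ T →
    ⟨ g n m S , T ⟩ ≡ sgn (sum (map (λ d → suc (toℕ d)) (elements (S ∩ T))) + suc ∣ S ∩ T ∣ C 2 + 1)
  ⟨g⟩-∁⊆ ∣∁T∣≡m ∁T⊆S S≢T = begin
    vS S T -ℤ sumV (map (λ S′ → bar (tSwap S S′)) (mSubsetsOf m S)) T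
      ≡⟨ cong₂ _-ℤ_ (vS-≢ S≢T) (sumV-tSwap-∁⊆ S ∣∁S∣≡m ∣∁T∣≡m ∁T⊆S) ⟩
    0ℤ -ℤ sgn (inv (exchange (elements S) (∁ T) (elements (∁ S))))
      ≡⟨ ℤ.+-identityˡ _ ⟩
    - sgn (inv (exchange (elements S) (∁ T) (elements (∁ S))))
      ≡⟨ cong -_ (sgn-exchange-∁ S ∁T⊆S (trans ∣∁T∣≡m (sym ∣∁S∣≡m))) ⟩
    sgn (suc (Σ + suc ∣ S ∩ T ∣ C 2))
      ≡⟨ cong sgn (ℕ.+-comm 1 (Σ + suc ∣ S ∩ T ∣ C 2)) ⟩
    sgn (Σ + suc ∣ S ∩ T ∣ C 2 + 1) ∎
    where
    open ≡-Reasoning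
    Σ = sum (map (λ d → suc (toℕ d)) (elements (S ∩ T)))

∣∁p∣≡m : ∀ {n m} (p : Subset (n + m)) → ∣ p ∣ ≡ n → ∣ ∁ p ∣ ≡ m
∣∁p∣≡m {n} {m} p ∣p∣≡n = trans (∣∁p∣≡n∸∣p∣ p) (trans (cong (n + m ∸_) ∣p∣≡n) (ℕ.m+n∸m≡n n m))

module _ {n m : ℕ} (p q : Subset (n + m)) (∣p∣≡n : ∣ p ∣ ≡ n) (∣q∣≡n : ∣ q ∣ ≡ n) where

  open ≡-Reasoning

  ∁q⊆p⇒∣p∩q∣≡n∸m : ∁ q ⊆ p → ∣ p ∩ q ∣ ≡ n ∸ m
  ∁q⊆p⇒∣p∩q∣≡n∸m ∁q⊆p = trans (sym (ℕ.m+n∸n≡m ∣ p ∩ q ∣ m)) (cong (_∸ m) (begin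
    ∣ p ∩ q ∣ + m        ≡⟨ cong (∣ p ∩ q ∣ +_) (∣∁p∣≡m q ∣q∣≡n) ⟨
    ∣ p ∩ q ∣ + ∣ ∁ q ∣  ≡⟨ ∁q⊆p⇒∣p∩q∣+∣∁q∣≡∣p∣ p q ∁q⊆p ⟩
    ∣ p ∣                ≡⟨ ∣p∣≡n ⟩
    n                    ∎))

  ∣p∩q∣≡n∸m⇒∁q⊆p : m ≤ n → ∣ p ∩ q ∣ ≡ n ∸ m → ∁ q ⊆ p
  ∣p∩q∣≡n∸m⇒∁q⊆p m≤n ∣p∩q∣≡n∸m = ∣p∩q∣+∣∁q∣≡∣p∣⇒∁q⊆p p q (begin
    ∣ p ∩ q ∣ + ∣ ∁ q ∣  ≡⟨ cong₂ _+_ ∣p∩q∣≡n∸m (∣∁p∣≡m q ∣q∣≡n) ⟩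
    n ∸ m + m            ≡⟨ ℕ.m∸n+n≡m m≤n ⟩
    n                    ≡⟨ ∣p∣≡n ⟨
    ∣ p ∣                ∎)

  p≡q⇒∣p∩q∣≢n∸m : 1 ≤ m → m ≤ n → p ≡ q → ∣ p ∩ q ∣ ≢ n ∸ m
  p≡q⇒∣p∩q∣≢n∸m 1≤m m≤n p≡q ∣p∩q∣≡n∸m = ℕ.<-irrefl (begin
    n ∸ m      ≡⟨ ∣p∩q∣≡n∸m ⟨
    ∣ p ∩ q ∣  ≡⟨ cong (λ X → ∣ p ∩ X ∣) p≡q ⟨
    ∣ p ∩ p ∣  ≡⟨ cong ∣_∣ (∩-idem p) ⟩
    ∣ p ∣      ≡⟨ ∣p∣≡n ⟩
    n          ∎) (ℕ.∸-monoʳ-< 1≤m m≤n)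

lemma2p2 : (n m : ℕ) → 1 ≤ m → m ≤ n →
    (S T : Subset (n + m)) → ∣ S ∣ ≡ n → ∣ T ∣ ≡ n →
    (S ≡ T → ⟨ g n m S , T ⟩ ≡ 1ℤ)
    × (∣ S ∩ T ∣ ≡ n ∸ m →
        ⟨ g n m S , T ⟩
          ≡ sgn (sum (map (λ d → suc (toℕ d)) (elements (S ∩ T))) + (suc (n ∸ m) C 2) + 1))
    × (S ≢ T → n ∸ m < ∣ S ∩ T ∣ → ⟨ g n m S , T ⟩ ≡ 0ℤ)
lemma2p2 n m 1≤m m≤n S T ∣S∣≡n ∣T∣≡n = diagonal , opposite , far
  where
  ∣∁S∣≡m = ∣∁p∣≡m S ∣S∣≡n
  ∁T⊆S⇒∣S∩T∣≡n∸m = ∁q⊆p⇒∣p∩q∣≡n∸m S T ∣S∣≡n ∣T∣≡n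
  S≡T⇒∣S∩T∣≢n∸m = p≡q⇒∣p∩q∣≢n∸m S T ∣S∣≡n ∣T∣≡n 1≤m m≤n

  diagonal : S ≡ T → ⟨ g n m S , T ⟩ ≡ 1ℤ
  diagonal S≡T = trans (⟨g⟩-∁⊈ S T ∣∁S∣≡m (S≡T⇒∣S∩T∣≢n∸m S≡T ∘ ∁T⊆S⇒∣S∩T∣≡n∸m))
    (subst (λ X → vS S X ≡ 1ℤ) S≡T (vS-self S))

  opposite : ∣ S ∩ T ∣ ≡ n ∸ m →
    ⟨ g n m S , T ⟩ ≡ sgn (sum (map (λ d → suc (toℕ d)) (elements (S ∩ T))) + (suc (n ∸ m) C 2) + 1)
  opposite ∣S∩T∣≡n∸m = trans
    (⟨g⟩-∁⊆ S T ∣∁S∣≡m (∣∁p∣≡m T ∣T∣≡n) (∣p∩q∣≡n∸m⇒∁q⊆p S T ∣S∣≡n ∣T∣≡n m≤n ∣S∩T∣≡n∸m)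
      (λ S≡T → S≡T⇒∣S∩T∣≢n∸m S≡T ∣S∩T∣≡n∸m))
    (cong (λ k → sgn (sum (map (λ d → suc (toℕ d)) (elements (S ∩ T))) + suc k C 2 + 1)) ∣S∩T∣≡n∸m)

  far : S ≢ T → n ∸ m < ∣ S ∩ T ∣ → ⟨ g n m S , T ⟩ ≡ 0ℤ
  far S≢T n∸m<∣S∩T∣ = trans
    (⟨g⟩-∁⊈ S T ∣∁S∣≡m (λ ∁T⊆S → ℕ.<-irrefl (sym (∁T⊆S⇒∣S∩T∣≡n∸m ∁T⊆S)) n∸m<∣S∩T∣))
    (vS-≢ S≢T)
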